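{- Let $G$ be a graph containing no induced cycle of length $4$, and let $M$ be a module of $G$. Then every minimum interval deletion set $Q$ of $G$ either contains all vertices of $M$, or $Q\cap M$ is a minimum interval deletion set of $G[M]$.
   Context: Graphs are finite, simple, undirected. A module of $G$ is a set $M\subseteq V(G)$ such that every vertex of $M$ has the same neighbors outside $M$. An interval deletion set of a graph $H$ is a set $Q\subseteq V(H)$ such that $H-Q$ is an interval graph; it is minimum if no interval deletion set of $H$ is smaller. -}

module Defs where

open import Data.Nat using (ℕ; _≤_)
open import Data.Bool using (Bool; true; false)
open import Data.Fin using (Fin)
open import Data.Fin.Subset using (Subset; _∈_; _∉_; _⊆_; _─_; ∁; ∣_∣)
open import Data.Product using (Σ; _×_; ∃)
open import Relation.Binary.PropositionalEquality using (_≡_; _≢_)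
open import Function.Bundles using (_⇔_)

record Graph (n : ℕ) : Set where
  field
    adj   : Fin n → Fin n → Bool
    sym   : ∀ u v → adj u v ≡ adj v u
    irrefl : ∀ v → adj v v ≡ false
open Graph public

_~_ : ∀ {n} → Graph n → Fin n → Fin n → Set
(G ~ u) v = adj G u v ≡ true

HasInducedC4 : ∀ {n} → Graph n → Set
HasInducedC4 {n} G =
  Σ (Fin n) λ a → Σ (Fin n) λ b → Σ (Fin n) λ c → Σ (Fin n) λ d →
    (a ≢ b) × (a ≢ c) × (a ≢ d) × (b ≢ c) × (b ≢ d) × (c ≢ d) ×
    (G ~ a) b × (G ~ b) c × (G ~ c) d × (G ~ d) a ×
    adj G a c ≡ false × adj G b d ≡ false

IsModule : ∀ {n} → Graph n → Subset n → Set
IsModule {n} G M = ∀ (x y z : Fin n) → x ∈ M → y ∈ M → z ∉ M → adj G x z ≡ adj G y z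

IntervalsMeet : ℕ → ℕ → ℕ → ℕ → Set
IntervalsMeet l₁ r₁ l₂ r₂ = (l₁ ≤ r₂) × (l₂ ≤ r₁)

IsIntervalOn : ∀ {n} → Graph n → Subset n → Set
IsIntervalOn {n} G S =
  Σ (Fin n → ℕ) λ l → Σ (Fin n → ℕ) λ r →
    (∀ v → v ∈ S → l v ≤ r v) ×
    (∀ u v → u ∈ S → v ∈ S → u ≢ v →
       ((G ~ u) v ⇔ IntervalsMeet (l u) (r u) (l v) (r v)))

IsIDSOn : ∀ {n} → Graph n → Subset n → Subset n → Set
IsIDSOn G S Q = Q ⊆ S × IsIntervalOn G (S ─ Q)

IsMinIDSOn : ∀ {n} → Graph n → Subset n → Subset n → Set
IsMinIDSOn {n} G S Q = IsIDSOn G S Q × (∀ (Q' : Subset n) → IsIDSOn G S Q' → ∣ Q ∣ ≤ ∣ Q' ∣)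

V : ∀ {n} → Subset n
V {n} = ∁ (Data.Fin.Subset.⊥)

IsMinIDS : ∀ {n} → Graph n → Subset n → Set
IsMinIDS G Q = IsMinIDSOn G V Q

-- If some vertex u of the module M survives in G − Q, then (Q ─ M) ∪ Q′ is an
-- interval deletion set of G for every interval deletion set Q′ of G[M]: an
-- interval model of G[M] − Q′ can be substituted for u's interval. When M is
-- a clique, all of M may simply copy u's interval. Otherwise M contains a
-- non-edge xy, and two non-adjacent neighbours a, b of M outside M would
-- give the induced C4 x a y b; so u and its outside neighbours form a clique,
-- whose intervals share a point p (Helly), and a shrunken copy of the model
-- of G[M] − Q′ placed at p meets exactly the intervals that u's interval
-- meets. Counting then gives ∣ Q ∩ M ∣ ≤ ∣ Q′ ∣.
module Submission where

open import Defs
open import Data.Bool using (true; false; if_then_else_)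
import Data.Bool.Properties as Bool
open import Data.Empty using (⊥-elim)
open import Data.Fin using (Fin)
open import Data.Fin.Properties using (any?; _≟_)
open import Data.Fin.Subset using (Subset; _∈_; _∉_; _⊆_; _─_; _∪_; _∩_; ∣_∣; inside; outside)
open import Data.Fin.Subset.Properties
  using (_∈?_; nonempty?; x∈p∩q⁺; x∈p∪q⁺; x∈p∪q⁻; x∈p∧x∉q⇒x∈p─q; p─q⊆p; p∩q⊆q; x∉p⇒x∈∁p; ∉⊥)
open import Data.List.Base using (tabulate)
open import Data.List.Extrema.Nat using (max; xs≤max; max≤v⁺)
open import Data.List.Relation.Unary.All.Properties using (tabulate⁺; tabulate⁻)
open import Data.Nat using (ℕ; suc; _+_; _*_; _≤_; z≤n; s≤s)
open import Data.Nat.Properties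
  using (≤-trans; ≤-reflexive; n≤1+n; n<1+n; m≤m+n; m<1+n⇒m≤n; +-comm; +-assoc; +-suc; *-suc;
         +-mono-≤; +-monoˡ-≤; +-monoʳ-≤; +-monoʳ-<; *-monoʳ-≤; +-cancelˡ-≤; *-cancelˡ-<; module ≤-Reasoning)
open import Data.Product using (∃; ∃₂; _×_; _,_; proj₁; proj₂)
open import Data.Sum using (_⊎_; inj₁; inj₂)
open import Data.Vec using ([]; _∷_; here; there)
open import Function using (_∘_)
open import Function.Bundles using (_⇔_; mk⇔; Equivalence)
open import Function.Properties.Equivalence using (⇔-setoid)
import Function.Properties.Equivalence as ⇔
open import Level using (0ℓ)
open import Relation.Binary.PropositionalEquality as ≡ using (_≡_; _≢_; refl; cong)
open import Relation.Nullary using (¬_; yes; no; does)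
open import Relation.Nullary.Decidable using (_×-dec_; _⊎-dec_; ¬?)
open import Relation.Unary using (Pred; Decidable)

open Equivalence using (to; from)

private
  variable
    n : ℕ

x∈V : (x : Fin n) → x ∈ V
x∈V x = x∉p⇒x∈∁p ∉⊥

x∈p─q⇒x∉q : ∀ {x : Fin n} (p q : Subset n) → x ∈ p ─ q → x ∉ q
x∈p─q⇒x∉q (inside ∷ p)  (outside ∷ q) here ()
x∈p─q⇒x∉q (_ ∷ p)       (_ ∷ q)       (there x∈p─q) (there x∈q) = x∈p─q⇒x∉q p q x∈p─q x∈q

⊆⊎∃∉ : (p q : Subset n) → p ⊆ q ⊎ ∃ λ x → x ∈ p × x ∉ q
⊆⊎∃∉ p q with nonempty? (p ─ q)
... | yes (x , x∈p─q) = inj₂ (x , p─q⊆p p q x∈p─q , x∈p─q⇒x∉q p q x∈p─q)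
... | no empty = inj₁ p⊆q
  where
  p⊆q : p ⊆ q
  p⊆q {x} x∈p with x ∈? q
  ... | yes x∈q = x∈q
  ... | no x∉q = ⊥-elim (empty (x , x∈p∧x∉q⇒x∈p─q x∈p x∉q))

p─q∩p⊆V─q : (p q : Subset n) → p ─ (q ∩ p) ⊆ V ─ q
p─q∩p⊆V─q p q {x} x∈ =
  x∈p∧x∉q⇒x∈p─q (x∈V x) λ x∈q → x∈p─q⇒x∉q p (q ∩ p) x∈ (x∈p∩q⁺ (x∈q , p─q⊆p p _ x∈))

V─[q─p∪r]⊆[V─q─p]∪[p─r] : (p q r : Subset n) → V ─ ((q ─ p) ∪ r) ⊆ ((V ─ q) ─ p) ∪ (p ─ r)
V─[q─p∪r]⊆[V─q─p]∪[p─r] p q r {x} x∈ with x ∈? p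
... | yes x∈p = x∈p∪q⁺ (inj₂ (x∈p∧x∉q⇒x∈p─q x∈p (x∉ ∘ x∈p∪q⁺ ∘ inj₂)))
  where x∉ = x∈p─q⇒x∉q V _ x∈
... | no x∉p = x∈p∪q⁺ (inj₁ (x∈p∧x∉q⇒x∈p─q (x∈p∧x∉q⇒x∈p─q (x∈V x) x∉q) x∉p))
  where
  x∉q : x ∉ q
  x∉q x∈q = x∈p─q⇒x∉q V _ x∈ (x∈p∪q⁺ (inj₁ (x∈p∧x∉q⇒x∈p─q x∈q x∉p)))

∣p∪q∣≤∣p∣+∣q∣ : (p q : Subset n) → ∣ p ∪ q ∣ ≤ ∣ p ∣ + ∣ q ∣
∣p∪q∣≤∣p∣+∣q∣ []            []            = z≤n
∣p∪q∣≤∣p∣+∣q∣ (outside ∷ p) (outside ∷ q) = ∣p∪q∣≤∣p∣+∣q∣ p q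
∣p∪q∣≤∣p∣+∣q∣ (outside ∷ p) (inside ∷ q)  =
  ≤-trans (s≤s (∣p∪q∣≤∣p∣+∣q∣ p q)) (≤-reflexive (≡.sym (+-suc _ _)))
∣p∪q∣≤∣p∣+∣q∣ (inside ∷ p)  (outside ∷ q) = s≤s (∣p∪q∣≤∣p∣+∣q∣ p q)
∣p∪q∣≤∣p∣+∣q∣ (inside ∷ p)  (inside ∷ q)  =
  s≤s (≤-trans (∣p∪q∣≤∣p∣+∣q∣ p q) (+-monoʳ-≤ ∣ p ∣ (n≤1+n ∣ q ∣)))

∣p─q∣+∣p∩q∣≡∣p∣ : (p q : Subset n) → ∣ p ─ q ∣ + ∣ p ∩ q ∣ ≡ ∣ p ∣
∣p─q∣+∣p∩q∣≡∣p∣ []            []            = refl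
∣p─q∣+∣p∩q∣≡∣p∣ (outside ∷ p) (outside ∷ q) = ∣p─q∣+∣p∩q∣≡∣p∣ p q
∣p─q∣+∣p∩q∣≡∣p∣ (outside ∷ p) (inside ∷ q)  = ∣p─q∣+∣p∩q∣≡∣p∣ p q
∣p─q∣+∣p∩q∣≡∣p∣ (inside ∷ p)  (outside ∷ q) = cong suc (∣p─q∣+∣p∩q∣≡∣p∣ p q)
∣p─q∣+∣p∩q∣≡∣p∣ (inside ∷ p)  (inside ∷ q)  =
  ≡.trans (+-suc _ _) (cong suc (∣p─q∣+∣p∩q∣≡∣p∣ p q))

∣p─r∪q∣+∣p∩r∣≤∣p∣+∣q∣ : (p q r : Subset n) → ∣ (p ─ r) ∪ q ∣ + ∣ p ∩ r ∣ ≤ ∣ p ∣ + ∣ q ∣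
∣p─r∪q∣+∣p∩r∣≤∣p∣+∣q∣ p q r = begin
  ∣ (p ─ r) ∪ q ∣ + ∣ p ∩ r ∣    ≤⟨ +-monoˡ-≤ ∣ p ∩ r ∣ (∣p∪q∣≤∣p∣+∣q∣ (p ─ r) q) ⟩
  ∣ p ─ r ∣ + ∣ q ∣ + ∣ p ∩ r ∣  ≡⟨ +-assoc (∣ p ─ r ∣) (∣ q ∣) (∣ p ∩ r ∣) ⟩
  ∣ p ─ r ∣ + (∣ q ∣ + ∣ p ∩ r ∣) ≡⟨ cong (∣ p ─ r ∣ +_) (+-comm (∣ q ∣) (∣ p ∩ r ∣)) ⟩
  ∣ p ─ r ∣ + (∣ p ∩ r ∣ + ∣ q ∣) ≡⟨ +-assoc (∣ p ─ r ∣) (∣ p ∩ r ∣) (∣ q ∣) ⟨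
  ∣ p ─ r ∣ + ∣ p ∩ r ∣ + ∣ q ∣  ≡⟨ cong (_+ ∣ q ∣) (∣p─q∣+∣p∩q∣≡∣p∣ p r) ⟩
  ∣ p ∣ + ∣ q ∣                  ∎
  where open ≤-Reasoning

meets-sym : ∀ {a b c d} → IntervalsMeet a b c d ⇔ IntervalsMeet c d a b
meets-sym = mk⇔ (λ (p , q) → q , p) (λ (p , q) → q , p)

meets-shift : ∀ k {a b c d} → IntervalsMeet a b c d ⇔ IntervalsMeet (k + a) (k + b) (k + c) (k + d)
meets-shift k = mk⇔ (λ (p , q) → +-monoʳ-≤ k p , +-monoʳ-≤ k q)
                    (λ (p , q) → +-cancelˡ-≤ k _ _ p , +-cancelˡ-≤ k _ _ q)

stretch-≤ : ∀ k {a b} → a ≤ b → suc k * a ≤ suc k * b + k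
stretch-≤ k a≤b = ≤-trans (*-monoʳ-≤ (suc k) a≤b) (m≤m+n _ k)

stretch-≤⁻ : ∀ k {a b} → suc k * a ≤ suc k * b + k → a ≤ b
stretch-≤⁻ k {a} {b} h = m<1+n⇒m≤n (*-cancelˡ-< (suc k) a (suc b) (begin-strict
  suc k * a          ≤⟨ h ⟩
  suc k * b + k      <⟨ +-monoʳ-< (suc k * b) (n<1+n k) ⟩
  suc k * b + suc k  ≡⟨ +-comm (suc k * b) (suc k) ⟩
  suc k + suc k * b  ≡⟨ *-suc (suc k) b ⟨
  suc k * suc b      ∎))
  where open ≤-Reasoning

meets-stretch : ∀ k {a b c d} → IntervalsMeet a b c d ⇔
  IntervalsMeet (suc k * a) (suc k * b + k) (suc k * c) (suc k * d + k)
meets-stretch k = mk⇔ (λ (p , q) → stretch-≤ k p , stretch-≤ k q)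
                      (λ (p , q) → stretch-≤⁻ k p , stretch-≤⁻ k q)

copy-meets⇒meets : ∀ k {p a b lu ru lw rw} → lu ≤ p → p ≤ ru → b ≤ k →
  IntervalsMeet (suc k * p + a) (suc k * p + b) (suc k * lw) (suc k * rw + k) →
  IntervalsMeet (suc k * lu) (suc k * ru + k) (suc k * lw) (suc k * rw + k)
copy-meets⇒meets k lu≤p p≤ru b≤k (copy≤w , w≤copy) =
  ≤-trans (≤-trans (*-monoʳ-≤ (suc k) lu≤p) (m≤m+n _ _)) copy≤w ,
  ≤-trans w≤copy (+-mono-≤ (*-monoʳ-≤ (suc k) p≤ru) b≤k)

stabbed⇒copy-meets : ∀ k {p a b lw rw} → lw ≤ p → p ≤ rw → a ≤ k →
  IntervalsMeet (suc k * p + a) (suc k * p + b) (suc k * lw) (suc k * rw + k)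
stabbed⇒copy-meets k lw≤p p≤rw a≤k =
  +-mono-≤ (*-monoʳ-≤ (suc k) p≤rw) a≤k ,
  ≤-trans (*-monoʳ-≤ (suc k) lw≤p) (m≤m+n _ _)

sup : (Fin n → ℕ) → ℕ
sup f = max 0 (tabulate f)

≤-sup : (f : Fin n → ℕ) (i : Fin n) → f i ≤ sup f
≤-sup f = tabulate⁻ (xs≤max 0 (tabulate f))

sup-≤ : ∀ {f : Fin n → ℕ} {k} → (∀ i → f i ≤ k) → sup f ≤ k
sup-≤ f≤k = max≤v⁺ z≤n (tabulate⁺ f≤k)

-- The largest left endpoint in C lies in every interval of C.
helly : (l r : Fin n → ℕ) {C : Pred (Fin n) 0ℓ} → Decidable C →
  (∀ v w → C v → C w → IntervalsMeet (l v) (r v) (l w) (r w)) →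
  ∃ λ p → ∀ v → C v → l v ≤ p × p ≤ r v
helly {n} l r {C} C? meet = sup left , λ v Cv → l≤left v Cv , sup-≤ (λ w → left≤r w v Cv)
  where
  left : Fin n → ℕ
  left v = if does (C? v) then l v else 0
  l≤left : ∀ v → C v → l v ≤ sup left
  l≤left v Cv with C? v | ≤-sup left v
  ... | yes _  | l≤sup = l≤sup
  ... | no ¬Cv | _     = ⊥-elim (¬Cv Cv)
  left≤r : ∀ w v → C v → left w ≤ r v
  left≤r w v Cv with C? w
  ... | yes Cw = proj₁ (meet w v Cw Cv)
  ... | no _   = z≤n

Represents : Graph n → Subset n → (l r : Fin n → ℕ) → Set
Represents G S l r =
  (∀ v → v ∈ S → l v ≤ r v) ×
  (∀ u v → u ∈ S → v ∈ S → u ≢ v → ((G ~ u) v ⇔ IntervalsMeet (l u) (r u) (l v) (r v)))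

glue : Subset n → (Fin n → ℕ) → (Fin n → ℕ) → Fin n → ℕ
glue M f g v = if does (v ∈? M) then f v else g v

∈⇒∉⇒≢ : ∀ {M : Subset n} {x y} → x ∈ M → y ∉ M → x ≢ y
∈⇒∉⇒≢ x∈M y∉M refl = y∉M x∈M

module _ {n} (G : Graph n) where

  private
    variable
      M S T : Subset n
      u : Fin n
      l r l′ r′ : Fin n → ℕ

  ~-sym : ∀ u v → (G ~ u) v ⇔ (G ~ v) u
  ~-sym u v = mk⇔ (≡.trans (≡.sym (sym G u v))) (≡.trans (sym G u v))

  module-~ : ∀ {x y z} → IsModule G M → x ∈ M → y ∈ M → z ∉ M → (G ~ x) z ⇔ (G ~ y) z
  module-~ mod x∈M y∈M z∉M = mk⇔ (≡.trans (≡.sym x≈y)) (≡.trans x≈y)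
    where x≈y = mod _ _ _ x∈M y∈M z∉M

  clique⊎nonedge : ∀ M →
    (∀ x y → x ∈ M → y ∈ M → x ≢ y → (G ~ x) y) ⊎
    (∃₂ λ x y → x ∈ M × y ∈ M × x ≢ y × adj G x y ≡ false)
  clique⊎nonedge M
    with any? (λ x → any? (λ y → (x ∈? M) ×-dec (y ∈? M) ×-dec ¬? (x ≟ y) ×-dec (adj G x y Bool.≟ false)))
  ... | yes (x , y , nonedge) = inj₂ (x , y , nonedge)
  ... | no none = inj₁ λ x y x∈M y∈M x≢y → Bool.¬-not λ x≁y → none (x , y , x∈M , y∈M , x≢y , x≁y)

  outer-neighbours-adjacent : ∀ {x y a b} → ¬ HasInducedC4 G → IsModule G M →
    x ∈ M → y ∈ M → x ≢ y → adj G x y ≡ false → u ∈ M →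
    a ∉ M → b ∉ M → a ≢ b → (G ~ u) a → (G ~ u) b → (G ~ a) b
  outer-neighbours-adjacent {M = M} {u = u} {x = x} {y} {a} {b}
    noC4 mod x∈M y∈M x≢y x≁y u∈M a∉M b∉M a≢b u~a u~b with adj G a b in a?b
  ... | true = refl
  ... | false = ⊥-elim (noC4 (x , a , y , b ,
        ∈⇒∉⇒≢ x∈M a∉M , x≢y , ∈⇒∉⇒≢ x∈M b∉M , ∈⇒∉⇒≢ y∈M a∉M ∘ ≡.sym , a≢b , ∈⇒∉⇒≢ y∈M b∉M ,
        ~M u~a x∈M a∉M , to (~-sym y a) (~M u~a y∈M a∉M) ,
        ~M u~b y∈M b∉M , to (~-sym x b) (~M u~b x∈M b∉M) , x≁y , a?b))
    where
    ~M : ∀ {v w} → (G ~ u) w → v ∈ M → w ∉ M → (G ~ v) w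
    ~M u~w v∈M w∉M = from (module-~ mod v∈M u∈M w∉M) u~w

  isIntervalOn-⊆ : ∀ {S′} → S′ ⊆ S → IsIntervalOn G S → IsIntervalOn G S′
  isIntervalOn-⊆ S′⊆S (l , r , l≤r , adj⇔) =
    l , r , (λ v v∈ → l≤r v (S′⊆S v∈)) , λ v w v∈ w∈ → adj⇔ v w (S′⊆S v∈) (S′⊆S w∈)

  represents-shift : ∀ k → Represents G S l r → Represents G S (λ v → k + l v) (λ v → k + r v)
  represents-shift k (l≤r , adj⇔) =
    (λ v v∈S → +-monoʳ-≤ k (l≤r v v∈S)) ,
    λ v w v∈S w∈S v≢w → ⇔.trans (adj⇔ v w v∈S w∈S v≢w) (meets-shift k)

  represents-stretch : ∀ k → Represents G S l r →
    Represents G S (λ v → suc k * l v) (λ v → suc k * r v + k)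
  represents-stretch k (l≤r , adj⇔) =
    (λ v v∈S → stretch-≤ k (l≤r v v∈S)) ,
    λ v w v∈S w∈S v≢w → ⇔.trans (adj⇔ v w v∈S w∈S v≢w) (meets-stretch k)

  substitute : IsModule G M → u ∈ M → u ∈ S → T ⊆ M →
    Represents G S l r → Represents G T l′ r′ →
    (∀ v w → v ∈ T → w ∈ S → w ∉ M →
       IntervalsMeet (l′ v) (r′ v) (l w) (r w) ⇔ IntervalsMeet (l u) (r u) (l w) (r w)) →
    Represents G ((S ─ M) ∪ T) (glue M l′ l) (glue M r′ r)
  substitute {M = M} {u = u} {S = S} {T = T} {l = l} {r = r} {l′ = l′} {r′ = r′}
    mod u∈M u∈S T⊆M (l≤r , adj⇔) (l′≤r′ , adj⇔′) mimics = l≤r″ , adj⇔″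
    where
    inT : ∀ {v} → v ∈ (S ─ M) ∪ T → v ∈ M → v ∈ T
    inT v∈ v∈M with x∈p∪q⁻ (S ─ M) T v∈
    ... | inj₁ v∈S─M = ⊥-elim (x∈p─q⇒x∉q S M v∈S─M v∈M)
    ... | inj₂ v∈T   = v∈T
    inS : ∀ {v} → v ∈ (S ─ M) ∪ T → v ∉ M → v ∈ S
    inS v∈ v∉M with x∈p∪q⁻ (S ─ M) T v∈
    ... | inj₁ v∈S─M = p─q⊆p S M v∈S─M
    ... | inj₂ v∈T   = ⊥-elim (v∉M (T⊆M v∈T))
    across : ∀ v w → v ∈ T → w ∈ S → w ∉ M → (G ~ v) w ⇔ IntervalsMeet (l′ v) (r′ v) (l w) (r w)
    across v w v∈T w∈S w∉M = begin
      (G ~ v) w                                ≈⟨ module-~ mod (T⊆M v∈T) u∈M w∉M ⟩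
      (G ~ u) w                                ≈⟨ adj⇔ u w u∈S w∈S (∈⇒∉⇒≢ u∈M w∉M) ⟩
      IntervalsMeet (l u) (r u) (l w) (r w)    ≈⟨ mimics v w v∈T w∈S w∉M ⟨
      IntervalsMeet (l′ v) (r′ v) (l w) (r w)  ∎
      where open import Relation.Binary.Reasoning.Setoid (⇔-setoid 0ℓ)
    l≤r″ : ∀ v → v ∈ (S ─ M) ∪ T → glue M l′ l v ≤ glue M r′ r v
    l≤r″ v v∈ with v ∈? M
    ... | yes v∈M = l′≤r′ v (inT v∈ v∈M)
    ... | no v∉M  = l≤r v (inS v∈ v∉M)
    adj⇔″ : ∀ v w → v ∈ (S ─ M) ∪ T → w ∈ (S ─ M) ∪ T → v ≢ w →
      (G ~ v) w ⇔ IntervalsMeet (glue M l′ l v) (glue M r′ r v) (glue M l′ l w) (glue M r′ r w)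
    adj⇔″ v w v∈ w∈ v≢w with v ∈? M | w ∈? M
    ... | yes v∈M | yes w∈M = adj⇔′ v w (inT v∈ v∈M) (inT w∈ w∈M) v≢w
    ... | yes v∈M | no w∉M  = across v w (inT v∈ v∈M) (inS w∈ w∉M) w∉M
    ... | no v∉M  | yes w∈M =
      ⇔.trans (~-sym v w) (⇔.trans (across w v (inT w∈ w∈M) (inS v∈ v∉M) v∉M) meets-sym)
    ... | no v∉M  | no w∉M  = adj⇔ v w (inS v∈ v∉M) (inS w∈ w∉M) v≢w

  substitute-clique : IsModule G M → u ∈ M → u ∈ S → T ⊆ M → Represents G S l r →
    (∀ x y → x ∈ M → y ∈ M → x ≢ y → (G ~ x) y) → IsIntervalOn G ((S ─ M) ∪ T)
  substitute-clique {M = M} {u = u} {T = T} {l = l} {r = r} mod u∈M u∈S T⊆M rep clique =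
    _ , _ , substitute {M = M} mod u∈M u∈S T⊆M rep copies (λ _ _ _ _ _ → ⇔.refl)
    where
    lu≤ru = proj₁ rep u u∈S
    copies : Represents G T (λ _ → l u) (λ _ → r u)
    copies = (λ _ _ → lu≤ru) ,
      λ v w v∈T w∈T v≢w → mk⇔ (λ _ → lu≤ru , lu≤ru) (λ _ → clique v w (T⊆M v∈T) (T⊆M w∈T) v≢w)

  -- Stretching the model of S by k + 1 frees room for a copy of the model of
  -- T, all of whose intervals lie in [0, k], at (k + 1) p.
  substitute-at-point : IsModule G M → u ∈ M → u ∈ S → T ⊆ M →
    Represents G S l r → Represents G T l′ r′ →
    ∀ p → l u ≤ p → p ≤ r u → (∀ w → w ∈ S → w ∉ M → (G ~ u) w → l w ≤ p × p ≤ r w) →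
    IsIntervalOn G ((S ─ M) ∪ T)
  substitute-at-point {M = M} {u = u} {S = S} {T = T} {l = l} {r = r} {l′ = l′} {r′ = r′}
    mod u∈M u∈S T⊆M rep rep′ p lu≤p p≤ru stabs =
    _ , _ , substitute {M = M} mod u∈M u∈S T⊆M rep^ (represents-shift (suc k * p) rep′) mimics
    where
    k = sup r′
    rep^ = represents-stretch k rep
    r′≤k : ∀ v → r′ v ≤ k
    r′≤k = ≤-sup r′
    mimics : ∀ v w → v ∈ T → w ∈ S → w ∉ M →
      IntervalsMeet (suc k * p + l′ v) (suc k * p + r′ v) (suc k * l w) (suc k * r w + k) ⇔
      IntervalsMeet (suc k * l u) (suc k * r u + k) (suc k * l w) (suc k * r w + k)
    mimics v w v∈T w∈S w∉M = mk⇔ (copy-meets⇒meets k lu≤p p≤ru (r′≤k v)) λ meets →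
      let u~w = from (proj₂ rep^ u w u∈S w∈S (∈⇒∉⇒≢ u∈M w∉M)) meets
          (lw≤p , p≤rw) = stabs w w∈S w∉M u~w
      in stabbed⇒copy-meets k lw≤p p≤rw (≤-trans (proj₁ rep′ v v∈T) (r′≤k v))

  substitute-module : ¬ HasInducedC4 G → IsModule G M → u ∈ M → u ∈ S → T ⊆ M →
    IsIntervalOn G S → IsIntervalOn G T → IsIntervalOn G ((S ─ M) ∪ T)
  substitute-module {M = M} {u = u} {S = S} noC4 mod u∈M u∈S T⊆M (l , r , rep) (_ , _ , rep′)
    with clique⊎nonedge M
  ... | inj₁ clique = substitute-clique mod u∈M u∈S T⊆M rep clique
  ... | inj₂ (x , y , x∈M , y∈M , x≢y , x≁y) =
    substitute-at-point mod u∈M u∈S T⊆M rep rep′ p lu≤p p≤ru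
      λ w w∈S w∉M u~w → stabs w (inj₂ (w∈S , w∉M , u~w))
    where
    Clique : Pred (Fin n) 0ℓ
    Clique w = w ≡ u ⊎ (w ∈ S × w ∉ M × (G ~ u) w)
    clique? : Decidable Clique
    clique? w = (w ≟ u) ⊎-dec ((w ∈? S) ×-dec ¬? (w ∈? M) ×-dec (adj G u w Bool.≟ true))
    ∈S : ∀ {w} → Clique w → w ∈ S
    ∈S (inj₁ refl)        = u∈S
    ∈S (inj₂ (w∈S , _)) = w∈S
    adjacent : ∀ v w → Clique v → Clique w → v ≢ w → (G ~ v) w
    adjacent _ _ (inj₁ refl)          (inj₁ refl)          u≢u = ⊥-elim (u≢u refl)
    adjacent _ _ (inj₁ refl)          (inj₂ (_ , _ , u~w)) _   = u~w
    adjacent _ _ (inj₂ (_ , _ , u~v)) (inj₁ refl)          _   = to (~-sym u _) u~v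
    adjacent _ _ (inj₂ (_ , v∉M , u~v)) (inj₂ (_ , w∉M , u~w)) v≢w =
      outer-neighbours-adjacent noC4 mod x∈M y∈M x≢y x≁y u∈M v∉M w∉M v≢w u~v u~w
    meets : ∀ v w → Clique v → Clique w → IntervalsMeet (l v) (r v) (l w) (r w)
    meets v w Cv Cw with v ≟ w
    ... | yes refl = let l≤r = proj₁ rep v (∈S Cv) in l≤r , l≤r
    ... | no v≢w   = to (proj₂ rep v w (∈S Cv) (∈S Cw) v≢w) (adjacent v w Cv Cw v≢w)
    p = proj₁ (helly l r clique? meets)
    stabs = proj₂ (helly l r clique? meets)
    lu≤p = proj₁ (stabs u (inj₁ refl))
    p≤ru = proj₂ (stabs u (inj₁ refl))

theorem4p5 : ∀ {n : ℕ} (G : Graph n) (M Q : Subset n) →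
    ¬ HasInducedC4 G → IsModule G M → IsMinIDS G Q →
    M ⊆ Q ⊎ IsMinIDSOn G M (Q ∩ M)
theorem4p5 G M Q noC4 mod ((_ , interval) , minimum) with ⊆⊎∃∉ M Q
... | inj₁ M⊆Q = inj₁ M⊆Q
... | inj₂ (u , u∈M , u∉Q) =
  inj₂ ((p∩q⊆q Q M , isIntervalOn-⊆ G (p─q∩p⊆V─q M Q) interval) , minimal)
  where
  minimal : ∀ Q′ → IsIDSOn G M Q′ → ∣ Q ∩ M ∣ ≤ ∣ Q′ ∣
  minimal Q′ (_ , interval′) = +-cancelˡ-≤ ∣ Q ∣ _ _ (begin
    ∣ Q ∣ + ∣ Q ∩ M ∣               ≤⟨ +-monoˡ-≤ ∣ Q ∩ M ∣ (minimum ((Q ─ M) ∪ Q′) replaced) ⟩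
    ∣ (Q ─ M) ∪ Q′ ∣ + ∣ Q ∩ M ∣    ≤⟨ ∣p─r∪q∣+∣p∩r∣≤∣p∣+∣q∣ Q Q′ M ⟩
    ∣ Q ∣ + ∣ Q′ ∣                  ∎)
    where
    open ≤-Reasoning
    replaced : IsIDSOn G V ((Q ─ M) ∪ Q′)
    replaced = (λ {x} _ → x∈V x) ,
      isIntervalOn-⊆ G (V─[q─p∪r]⊆[V─q─p]∪[p─r] M Q Q′)
        (substitute-module G noC4 mod u∈M (x∈p∧x∉q⇒x∈p─q (x∈V u) u∉Q) (p─q⊆p M Q′) interval interval′)
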